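{- Let $k\ge1$ and let $F_n^k(\mathbf z;q)=\sum_{\pi\in LP_n^k}\big(\prod_j z_{\ell_j}\big)q^{\mathrm{maj}(\pi)}$ as in the context. Then $F_0^k(\mathbf z;q)=1$ and for $n\ge1$ $$F_n^k(\mathbf z;q)=\sum_{i=1}^k z_i\,F_{n-i}^k(\mathbf z q^{i};q),$$ where $F_n^k=0$ for $n<0$ and $F_n^k(\mathbf zq^m;q)$ denotes $F_n^k$ evaluated at $(z_1q^m,z_2q^m,\dots,z_kq^m)$ in place of $\mathbf z$.
   Context: For a composition $(\ell_1,\dots,\ell_r)$ of $n$, the layered permutation of $[n]$ has first $\ell_1$ entries the $\ell_1$ largest elements of $[n]$ in increasing order, next $\ell_2$ entries the next $\ell_2$ largest in increasing order, etc.; these blocks are its layers. $LP_n^k$ is the set of layered permutations of $[n]$ with all layers of length at most $k$. $\mathbf z=(z_1,\dots,z_k)$ are indeterminates, and $F_n^k(\mathbf z;q)$ is regarded as a polynomial in $z_1,\dots,z_k,q$. The major index $\mathrm{maj}(\pi)$ is the sum of all $i$ with $\pi(i)>\pi(i+1)$. -}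

module Defs where

open import Level using (Level)
open import Algebra.Bundles using (CommutativeSemiring)
open import Data.Nat as ℕ using (ℕ; zero; suc; _∸_; _≤_; _<_; _≤?_; _<?_; _≟_)
open import Data.Fin using (Fin; toℕ; fromℕ<)
open import Data.List using (List; []; _∷_; _++_; map; upTo; concatMap; filter; foldr)
open import Data.Nat.ListAction using (sum)
open import Data.List.Relation.Unary.All using (All; all?)
open import Data.Product using (_×_)
open import Relation.Nullary.Decidable using (_×-dec_; yes; no)

allLists : ℕ → ℕ → List (List ℕ)
allLists zero    m = [] ∷ []
allLists (suc l) m = concatMap (λ x → map (x ∷_) (allLists l m)) (map suc (upTo m))

-- all lists of length ≤ n with entries in {1,…,n}; every composition of n is among them
candidates : ℕ → List (List ℕ)
candidates n = concatMap (λ l → allLists l n) (upTo (suc n))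

-- a composition of n with all parts ≤ k (parts are positive by construction of candidates)
IsComp : ℕ → ℕ → List ℕ → Set
IsComp k n ls = (sum ls ≡ n) × All (_≤ k) ls
  where open import Relation.Binary.PropositionalEquality using (_≡_)

-- the compositions of n with parts of length at most k (these index LP_n^k bijectively)
compositions : ℕ → ℕ → List (List ℕ)
compositions k n = filter (λ ls → (sum ls ≟ n) ×-dec all? (_≤? k) ls) (candidates n)

-- layered permutation (one-line notation π(1)…π(m)) of [m] with composition ls:
-- first ℓ₁ entries are the ℓ₁ largest elements in increasing order, etc.
layered : ℕ → List ℕ → List ℕ
layered m []       = []
layered m (l ∷ ls) = map (λ i → suc (m ∸ l) ℕ.+ i) (upTo l) ++ layered (m ∸ l) ls

descAt : ℕ → ℕ → ℕ → ℕ
descAt i a b with b <? a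
... | yes _ = i
... | no  _ = 0

-- majFrom i a xs: contribution of the word a ∷ xs whose first letter sits at position i
majFrom : ℕ → ℕ → List ℕ → ℕ
majFrom i a []       = 0
majFrom i a (b ∷ xs) = descAt i a b ℕ.+ majFrom (suc i) b xs

maj : List ℕ → ℕ
maj []       = 0
maj (a ∷ xs) = majFrom 1 a xs

-- The generating function, evaluated in an arbitrary commutative semiring.
-- (A polynomial identity in ℤ[z₁,…,z_k,q] with ℕ-coefficients on both sides
-- holds iff it holds under every evaluation in every commutative semiring.)

module _ {c ℓ : Level} (R : CommutativeSemiring c ℓ) where
  open CommutativeSemiring R

  sumR : List Carrier → Carrier
  sumR = foldr _+_ 0#

  prodR : List Carrier → Carrier
  prodR = foldr _*_ 1#

  pow : Carrier → ℕ → Carrier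
  pow x zero    = 1#
  pow x (suc m) = x * pow x m

  -- z_ℓ for 1 ≤ ℓ ≤ k (z indexed by Fin k, z_ℓ = z (ℓ-1)); 0 outside that range
  zAt : {k : ℕ} → (Fin k → Carrier) → ℕ → Carrier
  zAt {k} z zero    = 0#
  zAt {k} z (suc j) with j <? k
  ... | yes j<k = z (fromℕ< j<k)
  ... | no  _   = 0#

  F : (k n : ℕ) → (Fin k → Carrier) → Carrier → Carrier
  F k n z q = sumR (map (λ ls → prodR (map (zAt z) ls) * pow q (maj (layered n ls)))
                        (compositions k n))

  scale : {k : ℕ} → (Fin k → Carrier) → Carrier → ℕ → (Fin k → Carrier)
  scale z q m j = z j * pow q m

  -- F_m^k with the convention F_m^k = 0 for m < 0; here m = n - i given as (n , i)
  Fshift : (k n i : ℕ) → (Fin k → Carrier) → Carrier → Carrier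
  Fshift k n i z q with i ≤? n
  ... | yes _ = F k (n ∸ i) z q
  ... | no  _ = 0#

  RHS : (k n : ℕ) → (Fin k → Carrier) → Carrier → Carrier
  RHS k n z q = sumR (map (λ i → zAt z i * Fshift k n i (scale z q i) q) (map suc (upTo k)))

module Submission where

-- The recurrence F_n^k(z;q) = Σ_{i=1}^k z_i F_{n-i}^k(z q^i; q) comes from splitting a
-- layered permutation off its first layer.  If π has composition (i , ℓ₂ , … , ℓ_r) then its
-- descents sit at the partial sums of the composition, so
--     maj π = i · (r - 1) + maj π',
-- where π' is the layered permutation of (ℓ₂ , … , ℓ_r).  Since the weight of π' carries r - 1
-- factors z_ℓ, the extra factor q^{i(r-1)} is absorbed by evaluating at z q^i.

open import Defs
open import Algebra.Bundles using (CommutativeSemiring)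
open import Data.Nat using (ℕ; _≤_)
open import Data.Fin using (Fin)
open import Data.Product using (_×_)

open import Data.Nat using (zero; suc; _+_; _*_; _∸_; _<_; z≤n; s≤s; _≤?_; _<?_; _≟_)
open import Data.Nat.Properties using (≤-refl; ≤-trans; ≤-total; m≤m+n; m≤n+m; 1+n≰n; <⇒≤)
import Data.Nat.Properties as ℕ
open import Data.Nat.ListAction using (sum)
open import Data.Nat.Solver using (module +-*-Solver)
open import Data.List using (List; []; _∷_; _++_; map; upTo; applyUpTo; concatMap; filter; length)
open import Data.List.Properties using (map-applyUpTo; map-++; map-∘)
open import Data.List.Relation.Unary.All as All using (All; []; _∷_; all?)
open import Data.Product using (_,_)
open import Data.Sum using (inj₁; inj₂)
open import Data.Empty using (⊥-elim)
open import Function using (_∘_; id)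
open import Relation.Nullary using (¬_; Dec; yes; no)
open import Relation.Nullary.Decidable using (_×-dec_)
open import Relation.Unary using (Decidable)
import Relation.Binary.PropositionalEquality as ≡
open ≡ using (_≡_; _≢_; cong; cong₂)

Positive : List ℕ → Set
Positive = All (1 ≤_)

length≤sum : ∀ {ls} → Positive ls → length ls ≤ sum ls
length≤sum []                  = z≤n
length≤sum {suc l ∷ ls} (_ ∷ p) = s≤s (≤-trans (length≤sum p) (m≤n+m (sum ls) l))

entries≤sum : ∀ ls → All (_≤ sum ls) ls
entries≤sum []       = []
entries≤sum (l ∷ ls) =
  m≤m+n l (sum ls) ∷ All.map (λ h → ≤-trans h (m≤n+m (sum ls) l)) (entries≤sum ls)

sum-tail : ∀ {l ls n} → l + sum ls ≡ n → sum ls ≡ n ∸ l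
sum-tail {l} {ls} e = ≡.trans (≡.sym (ℕ.m+n∸m≡n l (sum ls))) (cong (_∸ l) e)

module MajorIndex where
  open ≡ using (refl)
  open ≡.≡-Reasoning
  open import Data.Nat.Properties using (m+n∸m≡n; +-suc; +-identityʳ; *-zeroʳ)
  open +-*-Solver using (solve; _:+_; _:*_; _:=_; con)

  ascendingRun : ℕ → ℕ → List ℕ
  ascendingRun c zero    = []
  ascendingRun c (suc t) = c ∷ ascendingRun (suc c) t

  applyUpTo-run : ∀ t c (f : ℕ → ℕ) → (∀ i → f i ≡ c + i) → applyUpTo f t ≡ ascendingRun c t
  applyUpTo-run zero    c f h = refl
  applyUpTo-run (suc t) c f h =
    cong₂ _∷_ (≡.trans (h 0) (+-identityʳ c))
              (applyUpTo-run t (suc c) (f ∘ suc) (λ i → ≡.trans (h (suc i)) (+-suc c i)))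

  layered-cons : ∀ l s ls → layered (l + s) (l ∷ ls) ≡ ascendingRun (suc s) l ++ layered s ls
  layered-cons l s ls =
    cong₂ _++_
      (≡.trans (map-applyUpTo id _ l)
               (applyUpTo-run l (suc s) _ (λ i → cong (λ m → suc m + i) (m+n∸m≡n l s))))
      (cong (λ m → layered m ls) (m+n∸m≡n l s))

  descAt-desc : ∀ i {a b} → b < a → descAt i a b ≡ i
  descAt-desc i {a} {b} b<a with b <? a
  ... | yes _   = refl
  ... | no b≮a  = ⊥-elim (b≮a b<a)

  descAt-asc : ∀ i {a b} → ¬ b < a → descAt i a b ≡ 0
  descAt-asc i {a} {b} b≮a with b <? a
  ... | yes b<a = ⊥-elim (b≮a b<a)
  ... | no _    = refl

  descAt-zero : ∀ a b → descAt 0 a b ≡ 0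
  descAt-zero a b with b <? a
  ... | yes _ = refl
  ... | no _  = refl

  -- maj is majFrom started at position 0 behind an arbitrary sentinel letter.
  maj-majFrom : ∀ a xs → maj xs ≡ majFrom 0 a xs
  maj-majFrom a []       = refl
  maj-majFrom a (b ∷ xs) = ≡.sym (cong (_+ majFrom 1 b xs) (descAt-zero a b))

  majFrom-run : ∀ t i a L → majFrom i a (ascendingRun (suc a) t ++ L) ≡ majFrom (i + t) (a + t) L
  majFrom-run zero    i a L =
    cong₂ (λ j b → majFrom j b L) (≡.sym (+-identityʳ i)) (≡.sym (+-identityʳ a))
  majFrom-run (suc t) i a L = begin
    descAt i a (suc a) + majFrom (suc i) (suc a) (ascendingRun (suc (suc a)) t ++ L)
      ≡⟨ cong₂ _+_ (descAt-asc i (λ a+1<a → 1+n≰n (<⇒≤ a+1<a))) (majFrom-run t (suc i) (suc a) L) ⟩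
    majFrom (suc i + t) (suc a + t) L
      ≡⟨ cong₂ (λ j b → majFrom j b L) (≡.sym (+-suc i t)) (≡.sym (+-suc a t)) ⟩
    majFrom (i + suc t) (a + suc t) L ∎

  -- The major index of the layered permutation of a composition (ℓ₁,…,ℓ_r): its descents
  -- are the partial sums ℓ₁+…+ℓ_j for j < r, so ℓ_j is counted r - j times.
  majComp : List ℕ → ℕ
  majComp []       = 0
  majComp (l ∷ ls) = l * length ls + majComp ls

  -- Behind a letter larger than all entries, each of the r layers starts with a descent,
  -- at positions j, j+ℓ₁, …; hence r·j on top of majComp.
  majFrom-layered : ∀ j a ls → Positive ls → sum ls < a →
    majFrom j a (layered (sum ls) ls) ≡ length ls * j + majComp ls
  majFrom-layered j a []             _         _  = refl
  majFrom-layered j a (suc l ∷ ls) (_ ∷ pos) lt = begin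
    majFrom j a (layered (suc l + s) (suc l ∷ ls))
      ≡⟨ cong (majFrom j a) (layered-cons (suc l) s ls) ⟩
    descAt j a (suc s) + majFrom (suc j) (suc s) (ascendingRun (suc (suc s)) l ++ layered s ls)
      ≡⟨ cong₂ _+_ (descAt-desc j s+1<a) (majFrom-run l (suc j) (suc s) _) ⟩
    j + majFrom (suc j + l) (suc s + l) (layered s ls)
      ≡⟨ cong (j +_) (majFrom-layered (suc j + l) (suc s + l) ls pos (s≤s (m≤m+n s l))) ⟩
    j + (length ls * (suc j + l) + majComp ls)
      ≡⟨ solve 4 (λ j l r m → j :+ (r :* ((con 1 :+ j) :+ l) :+ m)
                            := (con 1 :+ r) :* j :+ ((con 1 :+ l) :* r :+ m))
                 refl j l (length ls) (majComp ls) ⟩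
    suc (length ls) * j + (suc l * length ls + majComp ls) ∎
    where
    s = sum ls
    s+1<a : suc s < a
    s+1<a = ≤-trans (s≤s (s≤s (m≤n+m s l))) lt

  maj-layered : ∀ ls → Positive ls → maj (layered (sum ls) ls) ≡ majComp ls
  maj-layered ls pos = begin
    maj (layered (sum ls) ls)                     ≡⟨ maj-majFrom (suc (sum ls)) (layered (sum ls) ls) ⟩
    majFrom 0 (suc (sum ls)) (layered (sum ls) ls) ≡⟨ majFrom-layered 0 _ ls pos ≤-refl ⟩
    length ls * 0 + majComp ls                    ≡⟨ cong (_+ majComp ls) (*-zeroʳ (length ls)) ⟩
    majComp ls                                    ∎

open MajorIndex using (majComp; maj-layered)

module FiniteSums {c ℓ} (R : CommutativeSemiring c ℓ) where
  open CommutativeSemiring R renaming (_+_ to _⊕_; _*_ to _⊗_)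
  open import Relation.Binary.Reasoning.Setoid setoid
  open import Algebra.Properties.CommutativeSemigroup +-commutativeSemigroup using (interchange)

  S : ℕ → (ℕ → Carrier) → Carrier
  S zero    h = 0#
  S (suc m) h = h 0 ⊕ S m (h ∘ suc)

  S-cong : ∀ m {g h} → (∀ i → g i ≈ h i) → S m g ≈ S m h
  S-cong zero    e = refl
  S-cong (suc m) e = +-cong (e 0) (S-cong m (e ∘ suc))

  S-vanish : ∀ m {h} → (∀ i → h i ≈ 0#) → S m h ≈ 0#
  S-vanish zero    e = refl
  S-vanish (suc m) e = trans (+-cong (e 0) (S-vanish m (e ∘ suc))) (+-identityˡ 0#)

  S-truncate : ∀ m m' {h} → m' ≤ m → (∀ i → m' ≤ i → h i ≈ 0#) → S m h ≈ S m' h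
  S-truncate m       zero     _         e = S-vanish m (λ i → e i z≤n)
  S-truncate (suc m) (suc m') (s≤s m'≤m) e =
    +-congˡ (S-truncate m m' m'≤m (λ i m'≤i → e (suc i) (s≤s m'≤i)))

  S-resize : ∀ m m' {h} → (∀ i → m ≤ i → h i ≈ 0#) → (∀ i → m' ≤ i → h i ≈ 0#) → S m h ≈ S m' h
  S-resize m m' e e' with ≤-total m m'
  ... | inj₁ m≤m' = sym (S-truncate m' m m≤m' e)
  ... | inj₂ m'≤m = S-truncate m m' m'≤m e'

  S-distrib : ∀ m g h → S m (λ i → g i ⊕ h i) ≈ S m g ⊕ S m h
  S-distrib zero    g h = sym (+-identityˡ 0#)
  S-distrib (suc m) g h = trans (+-congˡ (S-distrib m (g ∘ suc) (h ∘ suc))) (interchange _ _ _ _)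

  S-swap : ∀ m n (f : ℕ → ℕ → Carrier) → S m (λ i → S n (f i)) ≈ S n (λ j → S m (λ i → f i j))
  S-swap zero    n f = sym (S-vanish n (λ _ → refl))
  S-swap (suc m) n f = trans (+-congˡ (S-swap m n (f ∘ suc))) (sym (S-distrib n (f 0) _))

  S-scale : ∀ m a h → a ⊗ S m h ≈ S m (λ i → a ⊗ h i)
  S-scale zero    a h = zeroʳ a
  S-scale (suc m) a h = trans (distribˡ a _ _) (+-congˡ (S-scale m a (h ∘ suc)))

  sumR-applyUpTo : ∀ {a} {A : Set a} m (f : ℕ → A) (g : A → Carrier) →
    sumR R (map g (applyUpTo f m)) ≡ S m (g ∘ f)
  sumR-applyUpTo zero    f g = ≡.refl
  sumR-applyUpTo (suc m) f g = cong (g (f 0) ⊕_) (sumR-applyUpTo m (f ∘ suc) g)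

  sumR-++ : ∀ xs ys → sumR R (xs ++ ys) ≈ sumR R xs ⊕ sumR R ys
  sumR-++ []       ys = sym (+-identityˡ _)
  sumR-++ (x ∷ xs) ys = trans (+-congˡ (sumR-++ xs ys)) (sym (+-assoc _ _ _))

  sumR-concatMap : ∀ {a b} {A : Set a} {B : Set b} (g : A → List B) (f : B → Carrier) xs →
    sumR R (map f (concatMap g xs)) ≈ sumR R (map (λ x → sumR R (map f (g x))) xs)
  sumR-concatMap g f []       = refl
  sumR-concatMap g f (x ∷ xs) = begin
    sumR R (map f (g x ++ concatMap g xs))
      ≡⟨ cong (sumR R) (map-++ f (g x) (concatMap g xs)) ⟩
    sumR R (map f (g x) ++ map f (concatMap g xs))
      ≈⟨ sumR-++ (map f (g x)) _ ⟩
    sumR R (map f (g x)) ⊕ sumR R (map f (concatMap g xs))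
      ≈⟨ +-congˡ (sumR-concatMap g f xs) ⟩
    sumR R (map (λ y → sumR R (map f (g y))) (x ∷ xs)) ∎

  sumR-vanish : ∀ {a} {A : Set a} (f : A → Carrier) xs → (∀ x → f x ≈ 0#) → sumR R (map f xs) ≈ 0#
  sumR-vanish f []       e = refl
  sumR-vanish f (x ∷ xs) e = trans (+-cong (e x) (sumR-vanish f xs e)) (+-identityˡ 0#)

  sumR-scale : ∀ {a} {A : Set a} (a : Carrier) (f : A → Carrier) xs →
    a ⊗ sumR R (map f xs) ≈ sumR R (map (λ x → a ⊗ f x) xs)
  sumR-scale a f []       = zeroʳ a
  sumR-scale a f (x ∷ xs) = trans (distribˡ a _ _) (+-congˡ (sumR-scale a f xs))

  guard : ∀ {p} {P : Set p} → Dec P → Carrier → Carrier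
  guard (yes _) x = x
  guard (no _)  x = 0#

  sumR-filter : ∀ {a p} {A : Set a} {P : A → Set p} (P? : Decidable P) (w : A → Carrier) xs →
    sumR R (map w (filter P? xs)) ≈ sumR R (map (λ x → guard (P? x) (w x)) xs)
  sumR-filter P? w []       = refl
  sumR-filter P? w (x ∷ xs) with P? x
  ... | yes _ = +-congˡ (sumR-filter P? w xs)
  ... | no _  = trans (sumR-filter P? w xs) (sym (+-identityˡ _))

  Words : ℕ → ℕ → (List ℕ → Carrier) → Carrier
  Words l m f = sumR R (map f (allLists l m))

  Words-suc : ∀ l m f → Words (suc l) m f ≈ S m (λ i → Words l m (λ ls → f (suc i ∷ ls)))
  Words-suc l m f = begin
    sumR R (map f (concatMap (λ x → map (x ∷_) (allLists l m)) (map suc (upTo m))))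
      ≈⟨ sumR-concatMap (λ x → map (x ∷_) (allLists l m)) f (map suc (upTo m)) ⟩
    sumR R (map g (map suc (upTo m)))
      ≡⟨ cong (λ xs → sumR R (map g xs)) (map-applyUpTo id suc m) ⟩
    sumR R (map g (applyUpTo suc m))
      ≡⟨ sumR-applyUpTo m suc g ⟩
    S m (g ∘ suc)
      ≈⟨ S-cong m (λ i → reflexive (cong (sumR R) (≡.sym (map-∘ (allLists l m))))) ⟩
    S m (λ i → Words l m (λ ls → f (suc i ∷ ls))) ∎
    where
    g : ℕ → Carrier
    g x = sumR R (map f (map (x ∷_) (allLists l m)))

  Words-cong : ∀ l m {f g} → (∀ ls → Positive ls → length ls ≡ l → f ls ≈ g ls) →
    Words l m f ≈ Words l m g
  Words-cong zero    m e = +-congʳ (e [] [] ≡.refl)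
  Words-cong (suc l) m {f} {g} e = begin
    Words (suc l) m f                                 ≈⟨ Words-suc l m f ⟩
    S m (λ i → Words l m (λ ls → f (suc i ∷ ls)))
      ≈⟨ S-cong m (λ i → Words-cong l m (λ ls p len → e (suc i ∷ ls) (s≤s z≤n ∷ p) (cong suc len))) ⟩
    S m (λ i → Words l m (λ ls → g (suc i ∷ ls)))    ≈⟨ Words-suc l m g ⟨
    Words (suc l) m g                                 ∎

  Words-shrink : ∀ l m m' {f} → m' ≤ m → (∀ ls → ¬ All (_≤ m') ls → f ls ≈ 0#) →
    Words l m f ≈ Words l m' f
  Words-shrink zero    m m' m'≤m e = refl
  Words-shrink (suc l) m m' {f} m'≤m e = begin
    Words (suc l) m f                                  ≈⟨ Words-suc l m f ⟩
    S m (λ i → Words l m (λ ls → f (suc i ∷ ls)))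
      ≈⟨ S-cong m (λ i → Words-shrink l m m' m'≤m (λ ls ¬all → e (suc i ∷ ls) λ { (_ ∷ a) → ¬all a })) ⟩
    S m (λ i → Words l m' (λ ls → f (suc i ∷ ls)))
      ≈⟨ S-truncate m m' m'≤m (λ i m'≤i → sumR-vanish _ (allLists l m')
           (λ ls → e (suc i ∷ ls) λ { (i<m' ∷ _) → 1+n≰n (≤-trans i<m' m'≤i) })) ⟩
    S m' (λ i → Words l m' (λ ls → f (suc i ∷ ls)))   ≈⟨ Words-suc l m' f ⟨
    Words (suc l) m' f                                 ∎

  AllWords : ℕ → ℕ → (List ℕ → Carrier) → Carrier
  AllWords L m f = S L (λ l → Words l m f)

  AllWords-suc : ∀ L m f →
    AllWords (suc L) m f ≈ f [] ⊕ S m (λ i → AllWords L m (λ ls → f (suc i ∷ ls)))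
  AllWords-suc L m f =
    +-cong (+-identityʳ (f []))
           (trans (S-cong L (λ l → Words-suc l m f)) (S-swap L m _))

  AllWords-cong : ∀ L m {f g} → (∀ ls → Positive ls → f ls ≈ g ls) → AllWords L m f ≈ AllWords L m g
  AllWords-cong L m e = S-cong L (λ l → Words-cong l m (λ ls p _ → e ls p))

  AllWords-scale : ∀ L m a f → a ⊗ AllWords L m f ≈ AllWords L m (λ ls → a ⊗ f ls)
  AllWords-scale L m a f = trans (S-scale L a _) (S-cong L (λ l → sumR-scale a f (allLists l m)))

  AllWords-vanish : ∀ L m {f} → (∀ ls → f ls ≈ 0#) → AllWords L m f ≈ 0#
  AllWords-vanish L m {f} e = S-vanish L (λ l → sumR-vanish f (allLists l m) e)

  -- For f supported on words of sum s, any length bound L > s and letter bound m ≥ s cover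
  -- all of its support, so the sum equals the one with the tightest bounds.
  AllWords-stable : ∀ L m s {f} → (∀ ls → sum ls ≢ s → f ls ≈ 0#) → s < L → s ≤ m →
    AllWords L m f ≈ AllWords (suc s) s f
  AllWords-stable L m s {f} supp s<L s≤m = begin
    S L (λ l → Words l m f)        ≈⟨ S-truncate L (suc s) s<L tooLong ⟩
    S (suc s) (λ l → Words l m f)  ≈⟨ S-cong (suc s) (λ l → Words-shrink l m s s≤m letterTooBig) ⟩
    S (suc s) (λ l → Words l s f)  ∎
    where
    tooLong : ∀ l → suc s ≤ l → Words l m f ≈ 0#
    tooLong l s<l = trans
      (Words-cong l m {g = λ _ → 0#} (λ ls p len → supp ls λ { ≡.refl →
         1+n≰n (≤-trans s<l (≡.subst (_≤ sum ls) len (length≤sum p))) }))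
      (sumR-vanish _ (allLists l m) (λ _ → refl))
    letterTooBig : ∀ ls → ¬ All (_≤ s) ls → f ls ≈ 0#
    letterTooBig ls ¬all = supp ls λ { ≡.refl → ¬all (entries≤sum ls) }

module Recurrence {c ℓ} (R : CommutativeSemiring c ℓ) (k : ℕ) (q : CommutativeSemiring.Carrier R) where
  open CommutativeSemiring R renaming (_+_ to _⊕_; _*_ to _⊗_)
  open import Relation.Binary.Reasoning.Setoid setoid
  open FiniteSums R

  pow-+ : ∀ a b → pow R q (a + b) ≈ pow R q a ⊗ pow R q b
  pow-+ zero    b = sym (*-identityˡ _)
  pow-+ (suc a) b = trans (*-congˡ (pow-+ a b)) (sym (*-assoc _ _ _))

  zAt-out : (z : Fin k → Carrier) (i : ℕ) → ¬ suc i ≤ k → zAt R z (suc i) ≈ 0#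
  zAt-out z i i≮k with i <? k
  ... | yes i<k = ⊥-elim (i≮k i<k)
  ... | no _    = refl

  zAt-scale : (z : Fin k → Carrier) (m j : ℕ) → zAt R (scale R z q m) j ≈ zAt R z j ⊗ pow R q m
  zAt-scale z m zero    = sym (zeroˡ _)
  zAt-scale z m (suc j) with j <? k
  ... | yes _ = refl
  ... | no _  = sym (zeroˡ _)

  prodR-scale : (z : Fin k → Carrier) (m : ℕ) (ls : List ℕ) →
    prodR R (map (zAt R (scale R z q m)) ls) ≈ prodR R (map (zAt R z) ls) ⊗ pow R q (m * length ls)
  prodR-scale z m [] = sym (trans (*-congˡ (reflexive (cong (pow R q) (ℕ.*-zeroʳ m)))) (*-identityʳ 1#))
  prodR-scale z m (l ∷ ls) = begin
    zAt R (scale R z q m) l ⊗ prodR R (map (zAt R (scale R z q m)) ls)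
      ≈⟨ *-cong (zAt-scale z m l) (prodR-scale z m ls) ⟩
    (zAt R z l ⊗ pow R q m) ⊗ (prodR R (map (zAt R z) ls) ⊗ pow R q (m * length ls))
      ≈⟨ interchange _ _ _ _ ⟩
    (zAt R z l ⊗ prodR R (map (zAt R z) ls)) ⊗ (pow R q m ⊗ pow R q (m * length ls))
      ≈⟨ *-congˡ (pow-+ m (m * length ls)) ⟨
    (zAt R z l ⊗ prodR R (map (zAt R z) ls)) ⊗ pow R q (m + m * length ls)
      ≡⟨ cong (λ e → (zAt R z l ⊗ prodR R (map (zAt R z) ls)) ⊗ pow R q e)
              (≡.sym (ℕ.*-suc m (length ls))) ⟩
    (zAt R z l ⊗ prodR R (map (zAt R z) ls)) ⊗ pow R q (m * suc (length ls)) ∎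
    where open import Algebra.Properties.CommutativeSemigroup *-commutativeSemigroup using (interchange)

  weight : ℕ → (Fin k → Carrier) → List ℕ → Carrier
  weight n z ls = prodR R (map (zAt R z) ls) ⊗ pow R q (maj (layered n ls))

  -- The combinatorial heart: removing a first layer of size l costs the factor z_l, and the
  -- q^{l·(r-1)} coming from maj is absorbed into the weight at z q^l.
  weight-cons : ∀ z i ls → Positive ls →
    weight (suc i + sum ls) z (suc i ∷ ls) ≈ zAt R z (suc i) ⊗ weight (sum ls) (scale R z q (suc i)) ls
  weight-cons z i ls pos = begin
    (zl ⊗ P) ⊗ pow R q (maj (layered (sum (l ∷ ls)) (l ∷ ls)))
      ≡⟨ cong (λ e → (zl ⊗ P) ⊗ pow R q e) (maj-layered (l ∷ ls) (s≤s z≤n ∷ pos)) ⟩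
    (zl ⊗ P) ⊗ pow R q (l * length ls + majComp ls)
      ≈⟨ *-congˡ (pow-+ (l * length ls) (majComp ls)) ⟩
    (zl ⊗ P) ⊗ (pow R q (l * length ls) ⊗ pow R q (majComp ls))
      ≈⟨ *-assoc zl P _ ⟩
    zl ⊗ (P ⊗ (pow R q (l * length ls) ⊗ pow R q (majComp ls)))
      ≈⟨ *-congˡ (*-assoc P _ _) ⟨
    zl ⊗ ((P ⊗ pow R q (l * length ls)) ⊗ pow R q (majComp ls))
      ≈⟨ *-congˡ (*-cong (prodR-scale z l ls) (reflexive (cong (pow R q) (maj-layered ls pos)))) ⟨
    zl ⊗ weight (sum ls) (scale R z q (suc i)) ls ∎
    where
    l  = suc i
    zl = zAt R z l
    P  = prodR R (map (zAt R z) ls)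

  isComp? : ∀ n → Decidable (IsComp k n)
  isComp? n ls = (sum ls ≟ n) ×-dec all? (_≤? k) ls

  term : ℕ → (Fin k → Carrier) → List ℕ → Carrier
  term n z ls = guard (isComp? n ls) (weight n z ls)

  F-as-words : ∀ n z → F R k n z q ≈ AllWords (suc n) n (term n z)
  F-as-words n z = begin
    F R k n z q
      ≈⟨ sumR-filter (isComp? n) (weight n z) (candidates n) ⟩
    sumR R (map (term n z) (concatMap (λ l → allLists l n) (upTo (suc n))))
      ≈⟨ sumR-concatMap (λ l → allLists l n) (term n z) (upTo (suc n)) ⟩
    sumR R (map (λ l → Words l n (term n z)) (upTo (suc n)))
      ≡⟨ sumR-applyUpTo (suc n) id (λ l → Words l n (term n z)) ⟩
    AllWords (suc n) n (term n z) ∎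

  -- The empty composition is the only one of 0, with weight 1.
  F-zero : ∀ z → F R k 0 z q ≈ 1#
  F-zero z = trans (+-identityʳ _) (*-identityˡ 1#)

  term-support : ∀ n z ls → sum ls ≢ n → term n z ls ≈ 0#
  term-support n z ls sum≢n with isComp? n ls
  ... | yes (sum≡n , _) = ⊥-elim (sum≢n sum≡n)
  ... | no _            = refl

  -- A word with first letter i+1 is a composition of n iff i+1 ≤ k and the rest is a
  -- composition of n - (i+1); on compositions weight-cons applies.
  term-cons : ∀ n z i ls → Positive ls → suc i ≤ n →
    term n z (suc i ∷ ls) ≈ zAt R z (suc i) ⊗ term (n ∸ suc i) (scale R z q (suc i)) ls
  term-cons n z i ls pos i<n with isComp? n (suc i ∷ ls) | isComp? (n ∸ suc i) ls
  ... | yes (e₁ , _) | yes (e₂ , _) = begin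
    weight n z (suc i ∷ ls)                   ≡⟨ cong (λ m → weight m z (suc i ∷ ls)) (≡.sym e₁) ⟩
    weight (suc i + sum ls) z (suc i ∷ ls)    ≈⟨ weight-cons z i ls pos ⟩
    zAt R z (suc i) ⊗ weight (sum ls) w ls    ≡⟨ cong (λ m → zAt R z (suc i) ⊗ weight m w ls) e₂ ⟩
    zAt R z (suc i) ⊗ weight (n ∸ suc i) w ls ∎
    where w = scale R z q (suc i)
  ... | yes (e₁ , _ ∷ all≤k) | no ¬rest = ⊥-elim (¬rest (sum-tail {suc i} {ls} e₁ , all≤k))
  ... | no _ | no _ = sym (zeroʳ _)
  ... | no ¬comp | yes (e₂ , all≤k) = sym (trans (*-congʳ (zAt-out z i part>k)) (zeroˡ _))
    where
    part>k : ¬ suc i ≤ k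
    part>k i<k = ¬comp (≡.trans (cong (suc i +_) e₂) (ℕ.m+[n∸m]≡n i<n) , i<k ∷ all≤k)

  Fshift-yes : ∀ n i w → i ≤ n → Fshift R k n i w q ≡ F R k (n ∸ i) w q
  Fshift-yes n i w i≤n with i ≤? n
  ... | yes _   = ≡.refl
  ... | no i≰n = ⊥-elim (i≰n i≤n)

  Fshift-no : ∀ n i w → ¬ i ≤ n → Fshift R k n i w q ≡ 0#
  Fshift-no n i w i≰n with i ≤? n
  ... | yes i≤n = ⊥-elim (i≰n i≤n)
  ... | no _    = ≡.refl

  firstPart : ∀ n z i →
    AllWords n n (λ ls → term n z (suc i ∷ ls))
      ≈ zAt R z (suc i) ⊗ Fshift R k n (suc i) (scale R z q (suc i)) q
  firstPart n z i = byBound (suc i ≤? n)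
    where
    a = zAt R z (suc i)
    w = scale R z q (suc i)
    s = n ∸ suc i
    -- A case split on a Dec argument rather than 'with', which would also abstract the
    -- identical test inside Fshift.
    byBound : Dec (suc i ≤ n) →
      AllWords n n (λ ls → term n z (suc i ∷ ls)) ≈ a ⊗ Fshift R k n (suc i) w q
    byBound (yes i<n) = begin
      AllWords n n (λ ls → term n z (suc i ∷ ls))
        ≈⟨ AllWords-cong n n (λ ls pos → term-cons n z i ls pos i<n) ⟩
      AllWords n n (λ ls → a ⊗ term s w ls)        ≈⟨ AllWords-scale n n a (term s w) ⟨
      a ⊗ AllWords n n (term s w)
        ≈⟨ *-congˡ (AllWords-stable n n s (term-support s w)
                      (ℕ.∸-monoʳ-< (s≤s z≤n) i<n) (ℕ.m∸n≤m n (suc i))) ⟩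
      a ⊗ AllWords (suc s) s (term s w)            ≈⟨ *-congˡ (F-as-words s w) ⟨
      a ⊗ F R k s w q                              ≡⟨ cong (a ⊗_) (Fshift-yes n (suc i) w i<n) ⟨
      a ⊗ Fshift R k n (suc i) w q                 ∎
    byBound (no i≮n) = begin
      AllWords n n (λ ls → term n z (suc i ∷ ls))  ≈⟨ AllWords-vanish n n tooBig ⟩
      0#                                           ≈⟨ zeroʳ a ⟨
      a ⊗ 0#                                       ≡⟨ cong (a ⊗_) (Fshift-no n (suc i) w i≮n) ⟨
      a ⊗ Fshift R k n (suc i) w q                 ∎
      where
      tooBig : ∀ ls → term n z (suc i ∷ ls) ≈ 0#
      tooBig ls = term-support n z (suc i ∷ ls)
                    (λ e → i≮n (≡.subst (suc i ≤_) e (m≤m+n (suc i) (sum ls))))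

  recurrence : ∀ n → 1 ≤ n → (z : Fin k → Carrier) → F R k n z q ≈ RHS R k n z q
  recurrence (suc n) _ z = begin
    F R k (suc n) z q                           ≈⟨ F-as-words (suc n) z ⟩
    AllWords (suc (suc n)) (suc n) (term (suc n) z)
      ≈⟨ AllWords-suc (suc n) (suc n) (term (suc n) z) ⟩
    term (suc n) z []
      ⊕ S (suc n) (λ i → AllWords (suc n) (suc n) (λ ls → term (suc n) z (suc i ∷ ls)))
      ≈⟨ +-cong (term-support (suc n) z [] (λ ())) (S-cong (suc n) (firstPart (suc n) z)) ⟩
    0# ⊕ S (suc n) summand                      ≈⟨ +-identityˡ _ ⟩
    S (suc n) summand                           ≈⟨ S-resize (suc n) k beyondN beyondK ⟩
    S k summand                                 ≡⟨ RHS-as-S ⟨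
    RHS R k (suc n) z q                         ∎
    where
    summand : ℕ → Carrier
    summand i = zAt R z (suc i) ⊗ Fshift R k (suc n) (suc i) (scale R z q (suc i)) q
    beyondN : ∀ i → suc n ≤ i → summand i ≈ 0#
    beyondN i n<i =
      trans (*-congˡ (reflexive (Fshift-no (suc n) (suc i) _ (λ i<n → 1+n≰n (≤-trans i<n n<i)))))
            (zeroʳ _)
    beyondK : ∀ i → k ≤ i → summand i ≈ 0#
    beyondK i k≤i = trans (*-congʳ (zAt-out z i (λ i<k → 1+n≰n (≤-trans i<k k≤i)))) (zeroˡ _)
    g : ℕ → Carrier
    g i = zAt R z i ⊗ Fshift R k (suc n) i (scale R z q i) q
    RHS-as-S : RHS R k (suc n) z q ≡ S k summand
    RHS-as-S = ≡.trans (cong (λ xs → sumR R (map g xs)) (map-applyUpTo id suc k))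
                       (sumR-applyUpTo k suc g)

mainTheorem12 : ∀ {c ℓ} (R : CommutativeSemiring c ℓ) (k : ℕ) → 1 ≤ k →
    (∀ (z : Fin k → CommutativeSemiring.Carrier R) (q : CommutativeSemiring.Carrier R) →
      CommutativeSemiring._≈_ R (F R k 0 z q) (CommutativeSemiring.1# R))
    × (∀ (n : ℕ) → 1 ≤ n → (z : Fin k → CommutativeSemiring.Carrier R) (q : CommutativeSemiring.Carrier R) →
      CommutativeSemiring._≈_ R (F R k n z q) (RHS R k n z q))
mainTheorem12 R k _ =
  (λ z q → Recurrence.F-zero R k q z) ,
  (λ n n≥1 z q → Recurrence.recurrence R k q n n≥1 z)
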